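{- Let $q,d$ be positive integers and let $H$ be a bipartite graph with bipartition $X,Y$ that contains a matching covering every vertex of $X$, and such that $\deg(x) \leq q$ for each $x \in X$. If $|X| > 2(d-1)q$, then $H$ contains an induced matching with $d$ edges.
   Context: Graphs are finite and simple. An induced matching is a set of pairwise disjoint edges such that no edge of the graph joins two distinct edges of the set. -}

module Defs where

open import Data.Nat using (ℕ; _+_)
open import Data.Bool using (Bool; true; false; T)
open import Data.Fin using (Fin; zero; suc)
open import Data.Product using (Σ; _×_; _,_)
open import Relation.Binary.PropositionalEquality using (_≡_; _≢_)
open import Relation.Nullary using (¬_)
open import Function.Definitions using (Injective)

-- A finite simple bipartite graph with bipartition X = Fin m, Y = Fin n.
-- Since every edge joins X to Y, the graph is exactly a (decidable)
-- adjacency relation between X and Y.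
record BipGraph (m n : ℕ) : Set where
  field
    adj : Fin m → Fin n → Bool

open BipGraph public

Edge : ∀ {m n} → BipGraph m n → Fin m → Fin n → Set
Edge H x y = T (adj H x y)

count : ∀ {k} → (Fin k → Bool) → ℕ
count {ℕ.zero} p = 0
count {ℕ.suc k} p = if′ (p zero) + count {k} (λ i → p (suc i))
  where
    if′ : Bool → ℕ
    if′ true  = 1
    if′ false = 0

degX : ∀ {m n} → BipGraph m n → Fin m → ℕ
degX H x = count (adj H x)

HasXCoveringMatching : ∀ {m n} → BipGraph m n → Set
HasXCoveringMatching {m} {n} H =
  Σ (Fin m → Fin n) λ f → Injective _≡_ _≡_ f × (∀ x → Edge H x (f x))

-- An induced matching with d edges: edges (xs i, ys i), i ∈ Fin d, that are
-- pairwise disjoint (xs, ys injective), and no edge of H joins two distinct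
-- edges of the set. In a bipartite graph the only possible such edges are
-- xs i — ys j with i ≠ j.
InducedMatching : ∀ {m n} → BipGraph m n → ℕ → Set
InducedMatching {m} {n} H d =
  Σ (Fin d → Fin m) λ xs → Σ (Fin d → Fin n) λ ys →
    Injective _≡_ _≡_ xs × Injective _≡_ _≡_ ys ×
    (∀ i → Edge H (xs i) (ys i)) ×
    (∀ i j → i ≢ j → ¬ Edge H (xs i) (ys j))

-- Orient H into a digraph D on X, with x → x′ iff x f(x′) ∈ E(H) for the
-- X-covering matching f. Every vertex of D has out-degree at most q and a loop,
-- so d vertices of X that are pairwise non-adjacent in D are distinct and,
-- matched by f, form an induced matching. They are chosen greedily: within any
-- S ⊆ X the in-degrees sum to the out-degrees, hence to at most q|S|, so some
-- y ∈ S has at most q in- and q out-neighbours in S. Keeping y and discarding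
-- its neighbours costs at most 2q vertices, so d rounds fit into |X| > 2(d-1)q.
{-# OPTIONS --safe #-}
module Submission where

open import Defs
open import Data.Nat using (ℕ; zero; suc; _+_; _*_; _∸_; _≤_; _<_; z≤n; s≤s; _≤?_; NonZero; >-nonZero)
open import Data.Nat.Properties
  using (+-*-semiring; *-commutativeSemigroup; module ≤-Reasoning; ≤-reflexive; ≤-trans; <-irrefl; <-≤-trans; ≤-<-trans;
         ≰⇒>; n<1+n; +-identityʳ; +-mono-≤; +-monoˡ-≤; +-monoʳ-≤; *-monoʳ-≤; *-monoʳ-<; +-cancelˡ-<)
open import Data.Nat.Solver using (module +-*-Solver)
open import Algebra.Properties.Semiring.Sum +-*-semiring
open import Algebra.Properties.CommutativeSemigroup *-commutativeSemigroup using (x∙yz≈y∙xz)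
open import Data.Fin using (Fin; punchIn; punchOut) renaming (zero to fzero; suc to fsuc)
open import Data.Fin.Properties using (any?; punchIn-punchOut; punchOut-injective; suc-injective) renaming (_≟_ to _≟ᶠ_)
open import Data.Vec.Functional using (Vector; _∷_; [])
open import Data.Bool using (Bool; true; false; T; _∧_; _∨_; not)
open import Data.Bool.Properties using (T?)
open import Data.Unit using (tt)
open import Data.Empty using (⊥-elim)
open import Data.Product using (Σ-syntax; ∃-syntax; _×_; _,_; proj₁; proj₂)
open import Relation.Nullary using (¬_; yes; no)
open import Relation.Nullary.Decidable using (_×-dec_)
open import Relation.Binary.PropositionalEquality
open import Function.Base using (_∘_)
open import Function.Definitions using (Injective)
open import Function.Construct.Composition using () renaming (injective to ∘-injective)

χ : Bool → ℕ
χ true  = 1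
χ false = 0

χ*≤ : ∀ b n → χ b * n ≤ n
χ*≤ true  n = ≤-reflexive (+-identityʳ n)
χ*≤ false n = z≤n

∣_∣ : ∀ {k} → (Fin k → Bool) → ℕ
∣ S ∣ = sum (χ ∘ S)

full : ∀ {k} → Fin k → Bool
full _ = true

∣full∣≡k : ∀ k → ∣ full {k} ∣ ≡ k
∣full∣≡k zero    = refl
∣full∣≡k (suc k) = cong suc (∣full∣≡k k)

count≡∣∣ : ∀ {k} (S : Fin k → Bool) → count S ≡ ∣ S ∣
count≡∣∣ {zero}  S = refl
count≡∣∣ {suc k} S with S fzero
... | true  = cong suc (count≡∣∣ (S ∘ fsuc))
... | false = count≡∣∣ (S ∘ fsuc)

sum-mono-≤ : ∀ {k} {f g : Fin k → ℕ} → (∀ i → f i ≤ g i) → sum f ≤ sum g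
sum-mono-≤ {zero}  f≤g = z≤n
sum-mono-≤ {suc k} f≤g = +-mono-≤ (f≤g fzero) (sum-mono-≤ (f≤g ∘ fsuc))

sum-∘-injective-≤ : ∀ {k l} {f : Fin k → Fin l} → Injective _≡_ _≡_ f →
                    (g : Fin l → ℕ) → sum (g ∘ f) ≤ sum g
sum-∘-injective-≤ {zero}          f-inj g = z≤n
sum-∘-injective-≤ {suc k} {zero}  {f} f-inj g with f fzero
... | ()
sum-∘-injective-≤ {suc k} {suc l} {f} f-inj g = begin
  g p + sum (g ∘ f ∘ fsuc)               ≡⟨ cong (g p +_) (sum-cong-≗ (cong g ∘ sym ∘ punchIn-punchOut ∘ p≢)) ⟩
  g p + sum (g ∘ punchIn p ∘ f′)         ≤⟨ +-monoʳ-≤ (g p) (sum-∘-injective-≤ f′-inj (g ∘ punchIn p)) ⟩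
  g p + sum (g ∘ punchIn p)              ≡⟨ sum-remove {i = p} g ⟨
  sum g                                  ∎
  where
  open ≤-Reasoning
  p = f fzero
  p≢ : ∀ i → p ≢ f (fsuc i)
  p≢ i eq with f-inj eq
  ... | ()
  f′ : Fin k → Fin l
  f′ i = punchOut (p≢ i)
  f′-inj : Injective _≡_ _≡_ f′
  f′-inj {i} {j} eq = suc-injective (f-inj (punchOut-injective (p≢ i) (p≢ j) eq))

average≤⇒∃≤ : ∀ {k} (S : Fin k → Bool) (a : Fin k → ℕ) c → 0 < ∣ S ∣ →
              sum (λ i → χ (S i) * a i) ≤ ∣ S ∣ * c → ∃[ i ] T (S i) × a i ≤ c
average≤⇒∃≤ S a c 0<∣S∣ ∑≤ with any? (λ i → T? (S i) ×-dec (a i ≤? c))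
... | yes found = found
... | no none   = ⊥-elim (<-irrefl refl (<-≤-trans ∣S∣c<∑ ∑≤))
  where
  open ≤-Reasoning
  χ*suc≤ : ∀ i → χ (S i) * suc c ≤ χ (S i) * a i
  χ*suc≤ i with S i in Si
  ... | false = z≤n
  ... | true with a i ≤? c
  ...   | yes ai≤c = ⊥-elim (none (i , subst T (sym Si) tt , ai≤c))
  ...   | no  ai≰c = +-monoˡ-≤ 0 (≰⇒> ai≰c)
  ∣S∣c<∑ : ∣ S ∣ * c < sum (λ i → χ (S i) * a i)
  ∣S∣c<∑ = begin-strict
    ∣ S ∣ * c                      <⟨ *-monoʳ-< ∣ S ∣ {{>-nonZero 0<∣S∣}} (n<1+n c) ⟩
    ∣ S ∣ * suc c                  ≡⟨ *-distribʳ-sum (suc c) (χ ∘ S) ⟩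
    sum (λ i → χ (S i) * suc c)    ≤⟨ sum-mono-≤ χ*suc≤ ⟩
    sum (λ i → χ (S i) * a i)      ∎

module _ {m} (D : Fin m → Fin m → Bool) where

  inDegree outDegree : (Fin m → Bool) → Fin m → ℕ
  inDegree  S y = sum (λ x → χ (S x) * χ (D x y))
  outDegree S x = sum (λ y → χ (S y) * χ (D x y))

  Independent : ∀ {k} → Vector (Fin m) k → Set
  Independent xs = ∀ i j → i ≢ j → ¬ T (D (xs i) (xs j))

  IndependentTuple : (Fin m → Bool) → ℕ → Set
  IndependentTuple S k = Σ[ xs ∈ Vector (Fin m) k ] (∀ i → T (S (xs i))) × Independent xs

  nonNeighboursIn : (Fin m → Bool) → Fin m → Fin m → Bool
  nonNeighboursIn S y x = S x ∧ not (D x y ∨ D y x)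

  ∑-inDegree≡∑-outDegree : ∀ S → sum (λ y → χ (S y) * inDegree S y) ≡ sum (λ x → χ (S x) * outDegree S x)
  ∑-inDegree≡∑-outDegree S = begin
    sum (λ y → χ (S y) * inDegree S y)
      ≡⟨ sum-cong-≗ (λ y → *-distribˡ-sum (χ (S y)) (λ x → χ (S x) * χ (D x y))) ⟩
    sum (λ y → sum (λ x → χ (S y) * (χ (S x) * χ (D x y))))
      ≡⟨ ∑-comm (λ y x → χ (S y) * (χ (S x) * χ (D x y))) ⟩
    sum (λ x → sum (λ y → χ (S y) * (χ (S x) * χ (D x y))))
      ≡⟨ sum-cong-≗ (λ x → sum-cong-≗ (λ y → x∙yz≈y∙xz (χ (S y)) (χ (S x)) (χ (D x y)))) ⟩
    sum (λ x → sum (λ y → χ (S x) * (χ (S y) * χ (D x y))))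
      ≡⟨ sum-cong-≗ (λ x → *-distribˡ-sum (χ (S x)) (λ y → χ (S y) * χ (D x y))) ⟨
    sum (λ x → χ (S x) * outDegree S x)
      ∎
    where open ≡-Reasoning

  ∣∣≤inDegree+outDegree+∣nonNeighboursIn∣ : ∀ S y → ∣ S ∣ ≤ inDegree S y + outDegree S y + ∣ nonNeighboursIn S y ∣
  ∣∣≤inDegree+outDegree+∣nonNeighboursIn∣ S y = begin
    ∣ S ∣                                                      ≤⟨ sum-mono-≤ (λ x → split (S x) (D x y) (D y x)) ⟩
    sum (λ x → χ (S x) * χ (D x y) + χ (S x) * χ (D y x) + χ (nonNeighboursIn S y x))
      ≡⟨ ∑-distrib-+ (λ x → χ (S x) * χ (D x y) + χ (S x) * χ (D y x)) (χ ∘ nonNeighboursIn S y) ⟩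
    sum (λ x → χ (S x) * χ (D x y) + χ (S x) * χ (D y x)) + ∣ nonNeighboursIn S y ∣
      ≡⟨ cong (_+ ∣ nonNeighboursIn S y ∣) (∑-distrib-+ (λ x → χ (S x) * χ (D x y)) (λ x → χ (S x) * χ (D y x))) ⟩
    inDegree S y + outDegree S y + ∣ nonNeighboursIn S y ∣     ∎
    where
    open ≤-Reasoning
    split : ∀ s a b → χ s ≤ χ s * χ a + χ s * χ b + χ (s ∧ not (a ∨ b))
    split false a     b     = z≤n
    split true  true  b     = s≤s z≤n
    split true  false true  = s≤s z≤n
    split true  false false = s≤s z≤n

  nonNeighboursIn⇒ : ∀ S y x → T (nonNeighboursIn S y x) → T (S x) × ¬ T (D x y) × ¬ T (D y x)
  nonNeighboursIn⇒ S y x = T-∧-not-∨ (S x) (D x y) (D y x)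
    where
    T-∧-not-∨ : ∀ s a b → T (s ∧ not (a ∨ b)) → T s × ¬ T a × ¬ T b
    T-∧-not-∨ true false false _ = tt , (λ ()) , (λ ())

  ∷-independentTuple : ∀ {S y k} → T (S y) → IndependentTuple (nonNeighboursIn S y) k →
                       IndependentTuple S (suc k)
  ∷-independentTuple {S} {y} y∈S (xs , xs⊆S′ , xs-indep) = y ∷ xs , ∈S , indep
    where
    ∈S : ∀ i → T (S ((y ∷ xs) i))
    ∈S fzero    = y∈S
    ∈S (fsuc i) = let (xsᵢ∈S , _) = nonNeighboursIn⇒ S y (xs i) (xs⊆S′ i) in xsᵢ∈S
    indep : Independent (y ∷ xs)
    indep fzero    fzero    i≢j = ⊥-elim (i≢j refl)
    indep fzero    (fsuc j) _   = let (_ , _ , ¬yxⱼ) = nonNeighboursIn⇒ S y (xs j) (xs⊆S′ j) in ¬yxⱼ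
    indep (fsuc i) fzero    _   = let (_ , ¬xᵢy , _) = nonNeighboursIn⇒ S y (xs i) (xs⊆S′ i) in ¬xᵢy
    indep (fsuc i) (fsuc j) i≢j = xs-indep i j (i≢j ∘ cong fsuc)

  independent⇒injective : (∀ x → T (D x x)) → ∀ {k} {xs : Vector (Fin m) k} →
                          Independent xs → Injective _≡_ _≡_ xs
  independent⇒injective loop {xs = xs} indep {i} {j} xsᵢ≡xsⱼ with i ≟ᶠ j
  ... | yes i≡j = i≡j
  ... | no  i≢j = ⊥-elim (indep i j i≢j (subst (T ∘ D (xs i)) xsᵢ≡xsⱼ (loop (xs i))))

  module _ {q} (∣Dx∣≤q : ∀ x → ∣ D x ∣ ≤ q) where

    outDegree≤q : ∀ S x → outDegree S x ≤ q
    outDegree≤q S x = ≤-trans (sum-mono-≤ (λ y → χ*≤ (S y) (χ (D x y)))) (∣Dx∣≤q x)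

    ∃-inDegree≤q : ∀ S → 0 < ∣ S ∣ → ∃[ y ] T (S y) × inDegree S y ≤ q
    ∃-inDegree≤q S 0<∣S∣ = average≤⇒∃≤ S (inDegree S) q 0<∣S∣ (begin
      sum (λ y → χ (S y) * inDegree S y)   ≡⟨ ∑-inDegree≡∑-outDegree S ⟩
      sum (λ x → χ (S x) * outDegree S x)  ≤⟨ sum-mono-≤ (λ x → *-monoʳ-≤ (χ (S x)) (outDegree≤q S x)) ⟩
      sum (λ x → χ (S x) * q)              ≡⟨ *-distribʳ-sum q (χ ∘ S) ⟨
      ∣ S ∣ * q                            ∎)
      where open ≤-Reasoning

    greedyIndependentTuple : ∀ k S → k * (q + q) < ∣ S ∣ → IndependentTuple S (suc k)
    greedyIndependentTuple k S k[q+q]<∣S∣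
      with ∃-inDegree≤q S (≤-<-trans z≤n k[q+q]<∣S∣)
    ... | y , y∈S , inDegree≤q = ∷-independentTuple {S} {y} y∈S (rest k k[q+q]<∣S∣)
      where
      rest : ∀ k → k * (q + q) < ∣ S ∣ → IndependentTuple (nonNeighboursIn S y) k
      rest zero    _ = [] , (λ ()) , (λ ())
      rest (suc k) q+q+k[q+q]<∣S∣ = greedyIndependentTuple k (nonNeighboursIn S y)
        (+-cancelˡ-< (q + q) _ _ (<-≤-trans q+q+k[q+q]<∣S∣ (begin
          ∣ S ∣                                                  ≤⟨ ∣∣≤inDegree+outDegree+∣nonNeighboursIn∣ S y ⟩
          inDegree S y + outDegree S y + ∣ nonNeighboursIn S y ∣ ≤⟨ +-monoˡ-≤ _ (+-mono-≤ inDegree≤q (outDegree≤q S y)) ⟩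
          q + q + ∣ nonNeighboursIn S y ∣                        ∎)))
        where open ≤-Reasoning

lemma3p3 : (q d m n : ℕ) → .{{NonZero q}} → .{{NonZero d}} →
             (H : BipGraph m n) →
             HasXCoveringMatching H →
             (∀ (x : Fin m) → degX H x ≤ q) →
             2 * (d ∸ 1) * q < m →
             InducedMatching H d
lemma3p3 q zero    m n {{_}} {{()}}
lemma3p3 q (suc k) m n H (f , f-inj , matched) degX≤q 2kq<m =
  xs , f ∘ xs , xs-inj , ∘-injective _≡_ _≡_ _≡_ xs-inj f-inj , matched ∘ xs , xs-indep
  where
  D : Fin m → Fin m → Bool
  D x x′ = adj H x (f x′)
  ∣Dx∣≤q : ∀ x → ∣ D x ∣ ≤ q
  ∣Dx∣≤q x = ≤-trans (sum-∘-injective-≤ f-inj (χ ∘ adj H x))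
                     (subst (_≤ q) (count≡∣∣ (adj H x)) (degX≤q x))
  k[q+q]<∣full∣ : k * (q + q) < ∣ full {m} ∣
  k[q+q]<∣full∣ = subst₂ _<_ (solve 2 (λ k q → con 2 :* k :* q := k :* (q :+ q)) refl k q) (sym (∣full∣≡k m)) 2kq<m
    where open +-*-Solver
  tuple : IndependentTuple D full (suc k)
  tuple = greedyIndependentTuple D ∣Dx∣≤q k full k[q+q]<∣full∣
  xs : Vector (Fin m) (suc k)
  xs = proj₁ tuple
  xs-indep : Independent D xs
  xs-indep = proj₂ (proj₂ tuple)
  xs-inj : Injective _≡_ _≡_ xs
  xs-inj = independent⇒injective D matched xs-indep
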